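{- Let $b\ge2$ and $n\ge b^{16}$ be integers. For every real number $\epsilon$ with $n^{ -1/3}\le\epsilon\le 2/b$, $$\Bigg(\sum_{j>(b^{ -1}+\epsilon)n}+\sum_{j<(b^{ -1}-\epsilon)n}\Bigg) p_b(n,j)\le 2^{14}\, b^n e^{ -\epsilon^2 n/80}.$$
   Context: For integers $b\ge2$, $n\ge1$, $j\ge0$, $p_b(n,j)$ denotes the number of blocks (tuples) of length $n$ with entries in $\{0,1,\dots,b-1\}$ containing exactly $j$ copies of a given digit (by symmetry this does not depend on the digit). The sums are over integers $j$.
   Formalization: The parameter ε ranges over the rationals rather than over all real numbers. -}

module Defs where

open import Data.Nat as ℕ using (ℕ; zero; suc; _!)
open import Data.Fin using (Fin; toℕ)
open import Data.Vec using (Vec; []; _∷_)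
open import Data.List using (List; []; _∷_; [_]; map; concatMap; allFin; filter; length; upTo)
open import Data.Nat.ListAction using (sum)
open import Data.Nat.Properties using (_!≢0)
open import Data.Integer using (+_)
open import Data.Rational using (ℚ; _/_; _+_; _-_; _*_; _<_; 0ℚ; 1ℚ)
open import Data.Rational.Properties using (_<?_)
open import Relation.Nullary using (¬_)
open import Data.Sum using (_⊎_)
open import Relation.Nullary.Decidable using (_⊎-dec_)
open import Relation.Binary.PropositionalEquality using (_≡_)

blocks : (b n : ℕ) → List (Vec (Fin b) n)
blocks b zero    = [ [] ]
blocks b (suc n) = concatMap (λ x → map (x ∷_) (blocks b n)) (allFin b)

zeros : {b n : ℕ} → Vec (Fin b) n → ℕ
zeros []       = 0
zeros (x ∷ xs) with toℕ x
... | zero  = suc (zeros xs)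
... | suc _ = zeros xs

p : (b n j : ℕ) → ℕ
p b n j = length (filter (λ v → zeros v ℕ.≟ j) (blocks b n))

ℕ→ℚ : ℕ → ℚ
ℕ→ℚ m = + m / 1

-- 1/m as a rational (only used for m ≥ 2; value at 0 is irrelevant)
recip : ℕ → ℚ
recip zero    = 0ℚ
recip (suc m) = + 1 / suc m

_^ℚ_ : ℚ → ℕ → ℚ
x ^ℚ zero  = 1ℚ
x ^ℚ suc k = x * (x ^ℚ k)

-- the two-sided tail sum; p b n j = 0 for j > n, so j ranges over 0..n
tailSum : (b n : ℕ) (ε : ℚ) → ℕ
tailSum b n ε =
  sum (map (p b n) (filter (λ j → ((recip b + ε) * ℕ→ℚ n <? ℕ→ℚ j) ⊎-dec (ℕ→ℚ j <? (recip b - ε) * ℕ→ℚ n)) (upTo (suc n))))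

expPartial : ℚ → ℕ → ℚ
expPartial x zero    = 0ℚ
expPartial x (suc N) = expPartial x N + (x ^ℚ N) * (_/_ (+ 1) (N !) {{N !≢0}})

{-# OPTIONS --safe #-}
-- Chernoff's method, with rational stand-ins for the exponentials. Write ε = e₁/e₂, t = ε/2,
-- L = b·e₂ and u = 1 + t/L, so that w = uᴸ ≤ 1 + t + t² plays the role of eᵗ. Weighting a
-- block v by w^(zeros v) gives total weight (w + b − 1)ⁿ, while a block with more than
-- (1/b + ε)n zeros weighs at least u^(c·n), where c = L(1/b + ε) is an integer. The per-digit
-- estimate (1 + 2y)(w + b − 1) ≤ b·uᶜ with y = ε²/80 then bounds the number of such blocks
-- by bⁿ/(1 + 2y)ⁿ. The lower tail is the same argument for the nonzero digits, whose
-- proportion is (b − 1)/b. Finally the partial sums E of the exponential series satisfy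
-- E(ny) ≤ E(y)ⁿ ≤ (1 + 2y)ⁿ, by the binomial theorem for xᵏ/k! and since y ≤ 1.
module Submission where

open import Defs
open import Algebra.Bundles using (CommutativeMonoid; CommutativeRing; CommutativeSemiring)
import Algebra.Properties.CommutativeSemigroup as CommSemigroupProperties
open import Data.Empty using (⊥-elim)
open import Data.Fin using (Fin) renaming (zero to fzero; suc to fsuc)
open import Data.Integer as ℤ using (+_; -[1+_])
import Data.Integer.Properties as ℤ
import Data.Integer.Tactic.RingSolver as ℤ-Solver
open import Data.List using (List; []; _∷_; _++_; map; concatMap; allFin; tabulate; filter; length)
open import Data.List.Properties using (filter-accept; filter-reject; filter-none)
open import Data.List.Membership.Propositional using (_∈_)
open import Data.List.Membership.Propositional.Properties using (∈-filter⁻)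
open import Data.List.Relation.Unary.All using (All)
import Data.List.Relation.Unary.All as All
open import Data.List.Relation.Unary.AllPairs using ([]; _∷_)
open import Data.List.Relation.Unary.Any using (here; there)
open import Data.List.Relation.Unary.Unique.Propositional using (Unique)
import Data.List.Relation.Unary.Unique.Propositional.Properties as Unique
open import Data.Nat as ℕ using (ℕ; zero; suc; _!)
open import Data.Nat.ListAction using (sum)
import Data.Nat.Properties as ℕ
open import Data.Nat.Properties using (_!≢0)
open import Data.Product using (_×_; _,_; proj₂)
open import Data.Rational as ℚ using (ℚ; mkℚ; _+_; _*_; _-_; 0ℚ; 1ℚ; _≤_; _<_; toℚᵘ)
import Data.Rational.Properties as ℚ
import Data.Rational.Unnormalised as ℚᵘ
import Data.Rational.Unnormalised.Properties as ℚᵘ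
open import Data.Sum using (_⊎_; inj₁; inj₂)
open import Data.Vec using (Vec; []; _∷_)
open import Function using (_∘_)
open import Level using (0ℓ)
open import Relation.Binary.PropositionalEquality
open import Relation.Nullary using (Dec; yes; no)
open import Relation.Nullary.Decidable using (dec⇒maybe; _⊎-dec_)
import Tactic.RingSolver as RingSolver
import Tactic.RingSolver.Core.AlmostCommutativeRing as ACR

-- The zero test lets the solver drop vanishing constant coefficients, so it decides identities
-- that mix closed constants such as recip 80 and ℕ→ℚ 20.
ℚ-ring : ACR.AlmostCommutativeRing 0ℓ 0ℓ
ℚ-ring = ACR.fromCommutativeRing ℚ.+-*-commutativeRing (λ x → dec⇒maybe (0ℚ ℚ.≟ x))

open RingSolver using (solve-∀)

ℚ-commutativeSemiring : CommutativeSemiring 0ℓ 0ℓ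
ℚ-commutativeSemiring = CommutativeRing.commutativeSemiring ℚ.+-*-commutativeRing

open import Algebra.Properties.CommutativeSemiring.Exp ℚ-commutativeSemiring using (_^_; ^-homo-*; ^-assocʳ; ^-distrib-*)
module +-Properties = CommSemigroupProperties (CommutativeMonoid.commutativeSemigroup ℚ.+-0-commutativeMonoid)
module ℕ+-Properties = CommSemigroupProperties ℕ.+-commutativeSemigroup
module *-Properties = CommSemigroupProperties (CommutativeMonoid.commutativeSemigroup ℚ.*-1-commutativeMonoid)

open import Algebra.Properties.Semiring.Mult (CommutativeSemiring.semiring ℚ-commutativeSemiring) using (×-homo-+; ×1-homo-*) renaming (_×_ to _×ℚ_)

-- Rational arithmetic

*-monoˡ-≤ : ∀ {r p q} → 0ℚ ≤ r → p ≤ q → r * p ≤ r * q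
*-monoˡ-≤ {r} 0≤r = ℚ.*-monoˡ-≤-nonNeg r {{ℚ.nonNegative 0≤r}}

*-monoʳ-≤ : ∀ {r p q} → 0ℚ ≤ r → p ≤ q → p * r ≤ q * r
*-monoʳ-≤ {r} 0≤r = ℚ.*-monoʳ-≤-nonNeg r {{ℚ.nonNegative 0≤r}}

*-mono-≤ : ∀ {p q r s} → 0ℚ ≤ p → 0ℚ ≤ r → p ≤ q → r ≤ s → p * r ≤ q * s
*-mono-≤ 0≤p 0≤r p≤q r≤s = ℚ.≤-trans (*-monoʳ-≤ 0≤r p≤q) (*-monoˡ-≤ (ℚ.≤-trans 0≤p p≤q) r≤s)

*-nonNeg : ∀ {p q} → 0ℚ ≤ p → 0ℚ ≤ q → 0ℚ ≤ p * q
*-nonNeg {p} {q} 0≤p 0≤q = ℚ.≤-trans (ℚ.≤-reflexive (sym (ℚ.*-zeroˡ q))) (*-monoʳ-≤ 0≤q 0≤p)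

+-nonNeg : ∀ {p q} → 0ℚ ≤ p → 0ℚ ≤ q → 0ℚ ≤ p + q
+-nonNeg = ℚ.+-mono-≤

p≤p+q : ∀ {p q} → 0ℚ ≤ q → p ≤ p + q
p≤p+q {p} 0≤q = ℚ.≤-trans (ℚ.≤-reflexive (sym (ℚ.+-identityʳ p))) (ℚ.+-monoʳ-≤ p 0≤q)

*-pos : ∀ {p q} → 0ℚ < p → 0ℚ < q → 0ℚ < p * q
*-pos {p} {q} 0<p 0<q = ℚ.positive⁻¹ (p * q) {{ℚ.pos*pos⇒pos p {{ℚ.positive 0<p}} q {{ℚ.positive 0<q}}}}

q≤p+q : ∀ {p q} → 0ℚ ≤ p → q ≤ p + q
q≤p+q {p} {q} 0≤p = ℚ.≤-trans (p≤p+q 0≤p) (ℚ.≤-reflexive (ℚ.+-comm q p))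

0≤1 : 0ℚ ≤ 1ℚ
0≤1 = ℚ.nonNegative⁻¹ 1ℚ

*-cancelʳ-≤ : ∀ {p q r} → 0ℚ < r → p * r ≤ q * r → p ≤ q
*-cancelʳ-≤ {r = r} 0<r = ℚ.*-cancelʳ-≤-pos r {{ℚ.positive 0<r}}

*-inverse-unique : ∀ {a b c} → a * c ≡ 1ℚ → b * c ≡ 1ℚ → a ≡ b
*-inverse-unique {a} {b} {c} ac≡1 bc≡1 = begin
  a              ≡⟨ sym (ℚ.*-identityʳ a) ⟩
  a * 1ℚ         ≡⟨ cong (a *_) (sym bc≡1) ⟩
  a * (b * c)    ≡⟨ *-Properties.x∙yz≈xz∙y a b c ⟩
  (a * c) * b    ≡⟨ cong (_* b) ac≡1 ⟩
  1ℚ * b         ≡⟨ ℚ.*-identityˡ b ⟩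
  b              ∎
  where open ≡-Reasoning

toℚᵘ-ℕ→ℚ : ∀ m → toℚᵘ (ℕ→ℚ m) ℚᵘ.≃ ℚᵘ.mkℚᵘ (+ m) 0
toℚᵘ-ℕ→ℚ m = ℚ.toℚᵘ-fromℚᵘ (ℚᵘ.mkℚᵘ (+ m) 0)

ℕ→ℚ-suc : ∀ m → ℕ→ℚ (suc m) ≡ 1ℚ + ℕ→ℚ m
ℕ→ℚ-suc m = ℚ.toℚᵘ-injective (begin
  toℚᵘ (ℕ→ℚ (suc m))                  ≈⟨ toℚᵘ-ℕ→ℚ (suc m) ⟩
  ℚᵘ.mkℚᵘ (+ suc m) 0                  ≈⟨ ℚᵘ.*≡* (cross-multiply (+ m)) ⟩
  toℚᵘ 1ℚ ℚᵘ.+ ℚᵘ.mkℚᵘ (+ m) 0        ≈⟨ ℚᵘ.+-congʳ (toℚᵘ 1ℚ) (ℚᵘ.≃-sym (toℚᵘ-ℕ→ℚ m)) ⟩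
  toℚᵘ 1ℚ ℚᵘ.+ toℚᵘ (ℕ→ℚ m)           ≈⟨ ℚᵘ.≃-sym (ℚ.toℚᵘ-homo-+ 1ℚ (ℕ→ℚ m)) ⟩
  toℚᵘ (1ℚ + ℕ→ℚ m)                    ∎)
  where
  open ℚᵘ.≃-Reasoning
  cross-multiply : ∀ i → (+ 1 ℤ.+ i) ℤ.* (+ 1 ℤ.* + 1) ≡ (+ 1 ℤ.* + 1 ℤ.+ i ℤ.* + 1) ℤ.* + 1
  cross-multiply = ℤ-Solver.solve-∀

ℕ→ℚ≡×1 : ∀ m → ℕ→ℚ m ≡ m ×ℚ 1ℚ
ℕ→ℚ≡×1 zero    = refl
ℕ→ℚ≡×1 (suc m) = trans (ℕ→ℚ-suc m) (cong (_+_ 1ℚ) (ℕ→ℚ≡×1 m))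

ℕ→ℚ-homo-+ : ∀ m n → ℕ→ℚ (m ℕ.+ n) ≡ ℕ→ℚ m + ℕ→ℚ n
ℕ→ℚ-homo-+ m n rewrite ℕ→ℚ≡×1 (m ℕ.+ n) | ℕ→ℚ≡×1 m | ℕ→ℚ≡×1 n = ×-homo-+ 1ℚ m n

ℕ→ℚ-homo-* : ∀ m n → ℕ→ℚ (m ℕ.* n) ≡ ℕ→ℚ m * ℕ→ℚ n
ℕ→ℚ-homo-* m n rewrite ℕ→ℚ≡×1 (m ℕ.* n) | ℕ→ℚ≡×1 m | ℕ→ℚ≡×1 n = ×1-homo-* m n

ℕ→ℚ-homo-^ : ∀ m n → ℕ→ℚ (m ℕ.^ n) ≡ ℕ→ℚ m ^ℚ n
ℕ→ℚ-homo-^ m zero    = refl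
ℕ→ℚ-homo-^ m (suc n) = trans (ℕ→ℚ-homo-* m (m ℕ.^ n)) (cong (ℕ→ℚ m *_) (ℕ→ℚ-homo-^ m n))

ℕ→ℚ-suc-* : ∀ k x → ℕ→ℚ (suc k) * x ≡ x + ℕ→ℚ k * x
ℕ→ℚ-suc-* k x = begin
  ℕ→ℚ (suc k) * x           ≡⟨ cong (_* x) (ℕ→ℚ-suc k) ⟩
  (1ℚ + ℕ→ℚ k) * x          ≡⟨ ℚ.*-distribʳ-+ x 1ℚ (ℕ→ℚ k) ⟩
  1ℚ * x + ℕ→ℚ k * x        ≡⟨ cong (_+ ℕ→ℚ k * x) (ℚ.*-identityˡ x) ⟩
  x + ℕ→ℚ k * x             ∎
  where open ≡-Reasoning

ℕ→ℚ-nonNeg : ∀ m → 0ℚ ≤ ℕ→ℚ m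
ℕ→ℚ-nonNeg m = ℚ.nonNegative⁻¹ (ℕ→ℚ m) {{ℚ.normalize-nonNeg m 1}}

ℕ→ℚ-pos : ∀ m → 0ℚ < ℕ→ℚ (suc m)
ℕ→ℚ-pos m = ℚ.positive⁻¹ (ℕ→ℚ (suc m)) {{ℚ.normalize-pos (suc m) 1}}

ℕ→ℚ-mono-≤ : ∀ {m n} → m ℕ.≤ n → ℕ→ℚ m ≤ ℕ→ℚ n
ℕ→ℚ-mono-≤ {m} m≤n with ℕ.m≤n⇒∃[o]m+o≡n m≤n
... | o , refl = ℚ.≤-trans (p≤p+q (ℕ→ℚ-nonNeg o)) (ℚ.≤-reflexive (sym (ℕ→ℚ-homo-+ m o)))

ℕ→ℚ-cancel-≤ : ∀ {m n} → ℕ→ℚ m ≤ ℕ→ℚ n → m ℕ.≤ n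
ℕ→ℚ-cancel-≤ {m} {n} m≤n
  with ℚᵘ.≤-respʳ-≃ (toℚᵘ-ℕ→ℚ n) (ℚᵘ.≤-respˡ-≃ (toℚᵘ-ℕ→ℚ m) (ℚ.toℚᵘ-mono-≤ m≤n))
... | ℚᵘ.*≤* m≤n′ = ℤ.drop‿+≤+ (subst₂ ℤ._≤_ (ℤ.*-identityʳ (+ m)) (ℤ.*-identityʳ (+ n)) m≤n′)

/-*-denominator : ∀ i n .{{_ : ℕ.NonZero n}} → (+ i ℚ./ n) * ℕ→ℚ n ≡ ℕ→ℚ i
/-*-denominator i n@(suc k) = ℚ.toℚᵘ-injective (begin
  toℚᵘ ((+ i ℚ./ n) * ℕ→ℚ n)                          ≈⟨ ℚ.toℚᵘ-homo-* (+ i ℚ./ n) (ℕ→ℚ n) ⟩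
  toℚᵘ (+ i ℚ./ n) ℚᵘ.* toℚᵘ (ℕ→ℚ n)                  ≈⟨ ℚᵘ.*-cong (ℚ.toℚᵘ-fromℚᵘ (ℚᵘ.mkℚᵘ (+ i) k)) (toℚᵘ-ℕ→ℚ n) ⟩
  ℚᵘ.mkℚᵘ (+ i) k ℚᵘ.* ℚᵘ.mkℚᵘ (+ n) 0                 ≈⟨ ℚᵘ.*≡* (ℤ.*-assoc (+ i) (+ n) (+ 1)) ⟩
  ℚᵘ.mkℚᵘ (+ i) 0                                     ≈⟨ ℚᵘ.≃-sym (toℚᵘ-ℕ→ℚ i) ⟩
  toℚᵘ (ℕ→ℚ i)                                        ∎)
  where open ℚᵘ.≃-Reasoning

recip-* : ∀ m → recip (suc m) * ℕ→ℚ (suc m) ≡ 1ℚ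
recip-* m = /-*-denominator 1 (suc m)

recip-nonNeg : ∀ m → 0ℚ ≤ recip m
recip-nonNeg zero    = ℚ.≤-refl
recip-nonNeg (suc m) = ℚ.nonNegative⁻¹ (recip (suc m)) {{ℚ.normalize-nonNeg 1 (suc m)}}

ℕ→ℚ-suc-*-cancelˡ : ∀ k {p q} → ℕ→ℚ (suc k) * p ≡ ℕ→ℚ (suc k) * q → p ≡ q
ℕ→ℚ-suc-*-cancelˡ k {p} {q} eq = begin
  p                              ≡⟨ x≡r*[n*x] p ⟩
  r * (ℕ→ℚ (suc k) * p)          ≡⟨ cong (r *_) eq ⟩
  r * (ℕ→ℚ (suc k) * q)          ≡⟨ sym (x≡r*[n*x] q) ⟩
  q                              ∎
  where
  open ≡-Reasoning
  r = recip (suc k)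
  x≡r*[n*x] : ∀ x → x ≡ r * (ℕ→ℚ (suc k) * x)
  x≡r*[n*x] x = begin
    x                            ≡⟨ sym (ℚ.*-identityˡ x) ⟩
    1ℚ * x                       ≡⟨ cong (_* x) (sym (recip-* k)) ⟩
    r * ℕ→ℚ (suc k) * x          ≡⟨ ℚ.*-assoc r (ℕ→ℚ (suc k)) x ⟩
    r * (ℕ→ℚ (suc k) * x)        ∎

ℕ→ℚ-*-recip≤1 : ∀ {k m} → k ℕ.≤ suc m → ℕ→ℚ k * recip (suc m) ≤ 1ℚ
ℕ→ℚ-*-recip≤1 {k} {m} k≤1+m = begin
  ℕ→ℚ k * recip (suc m)          ≤⟨ *-monoʳ-≤ (recip-nonNeg (suc m)) (ℕ→ℚ-mono-≤ k≤1+m) ⟩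
  ℕ→ℚ (suc m) * recip (suc m)    ≡⟨ ℚ.*-comm (ℕ→ℚ (suc m)) (recip (suc m)) ⟩
  recip (suc m) * ℕ→ℚ (suc m)    ≡⟨ recip-* m ⟩
  1ℚ                             ∎
  where open ℚ.≤-Reasoning

*-↧ₙ≡∣↥∣ : ∀ q → 0ℚ ≤ q → q * ℕ→ℚ (ℚ.↧ₙ q) ≡ ℕ→ℚ ℤ.∣ ℚ.↥ q ∣
*-↧ₙ≡∣↥∣ q@(mkℚ (+ i) k _) _ = subst (λ r → r * ℕ→ℚ (suc k) ≡ ℕ→ℚ i) (ℚ.↥p/↧p≡p q) (/-*-denominator i (suc k))
*-↧ₙ≡∣↥∣ (mkℚ -[1+ _ ] _ _) 0≤q = ⊥-elim (ℤ.NonNegative.nonNeg (ℚ.nonNegative 0≤q))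

^ℚ≡^ : ∀ x n → x ^ℚ n ≡ x ^ n
^ℚ≡^ x zero    = refl
^ℚ≡^ x (suc n) = cong (x *_) (^ℚ≡^ x n)

^ℚ-homo-* : ∀ x m n → x ^ℚ (m ℕ.+ n) ≡ x ^ℚ m * x ^ℚ n
^ℚ-homo-* x m n rewrite ^ℚ≡^ x (m ℕ.+ n) | ^ℚ≡^ x m | ^ℚ≡^ x n = ^-homo-* x m n

^ℚ-assocʳ : ∀ x m n → (x ^ℚ m) ^ℚ n ≡ x ^ℚ (m ℕ.* n)
^ℚ-assocʳ x m n rewrite ^ℚ≡^ (x ^ℚ m) n | ^ℚ≡^ x m | ^ℚ≡^ x (m ℕ.* n) = ^-assocʳ x m n

^ℚ-distrib-* : ∀ x y n → (x * y) ^ℚ n ≡ x ^ℚ n * y ^ℚ n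
^ℚ-distrib-* x y n rewrite ^ℚ≡^ (x * y) n | ^ℚ≡^ x n | ^ℚ≡^ y n = ^-distrib-* x y n

1^ℚ : ∀ n → 1ℚ ^ℚ n ≡ 1ℚ
1^ℚ zero    = refl
1^ℚ (suc n) = trans (ℚ.*-identityˡ (1ℚ ^ℚ n)) (1^ℚ n)

^ℚ-nonNeg : ∀ {x} n → 0ℚ ≤ x → 0ℚ ≤ x ^ℚ n
^ℚ-nonNeg zero    _   = 0≤1
^ℚ-nonNeg (suc n) 0≤x = *-nonNeg 0≤x (^ℚ-nonNeg n 0≤x)

^ℚ-pos : ∀ {x} n → 0ℚ < x → 0ℚ < x ^ℚ n
^ℚ-pos zero    _   = ℚ.positive⁻¹ 1ℚ
^ℚ-pos (suc n) 0<x = *-pos 0<x (^ℚ-pos n 0<x)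

^ℚ-monoˡ-≤ : ∀ {x y} n → 0ℚ ≤ x → x ≤ y → x ^ℚ n ≤ y ^ℚ n
^ℚ-monoˡ-≤ zero    _   _   = ℚ.≤-refl
^ℚ-monoˡ-≤ (suc n) 0≤x x≤y = *-mono-≤ 0≤x (^ℚ-nonNeg n 0≤x) x≤y (^ℚ-monoˡ-≤ n 0≤x x≤y)

^ℚ-monoʳ-≤ : ∀ {x} → 1ℚ ≤ x → ∀ {m n} → m ℕ.≤ n → x ^ℚ m ≤ x ^ℚ n
^ℚ-monoʳ-≤ {x} 1≤x {m} m≤n with ℕ.m≤n⇒∃[o]m+o≡n m≤n
... | o , refl = begin
  x ^ℚ m             ≡⟨ sym (ℚ.*-identityʳ _) ⟩
  x ^ℚ m * 1ℚ        ≡⟨ cong (x ^ℚ m *_) (sym (1^ℚ o)) ⟩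
  x ^ℚ m * 1ℚ ^ℚ o   ≤⟨ *-monoˡ-≤ (^ℚ-nonNeg m (ℚ.≤-trans 0≤1 1≤x)) (^ℚ-monoˡ-≤ o 0≤1 1≤x) ⟩
  x ^ℚ m * x ^ℚ o    ≡⟨ sym (^ℚ-homo-* x m o) ⟩
  x ^ℚ (m ℕ.+ o)     ∎
  where open ℚ.≤-Reasoning

-- The truncated exponential series

1/_! : ℕ → ℚ
1/ k ! = ℚ._/_ (+ 1) (k !) {{k !≢0}}

1/!-suc : ∀ k → 1/ suc k ! * ℕ→ℚ (suc k) ≡ 1/ k !
1/!-suc k = *-inverse-unique [k+1]!⁻¹*[k+1]*k!≡1 (/-*-denominator 1 (k !) {{k !≢0}})
  where
  [k+1]!⁻¹*[k+1]*k!≡1 : 1/ suc k ! * ℕ→ℚ (suc k) * ℕ→ℚ (k !) ≡ 1ℚ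
  [k+1]!⁻¹*[k+1]*k!≡1 = begin
    1/ suc k ! * ℕ→ℚ (suc k) * ℕ→ℚ (k !)      ≡⟨ ℚ.*-assoc (1/ suc k !) _ _ ⟩
    1/ suc k ! * (ℕ→ℚ (suc k) * ℕ→ℚ (k !))    ≡⟨ cong (1/ suc k ! *_) (sym (ℕ→ℚ-homo-* (suc k) (k !))) ⟩
    1/ suc k ! * ℕ→ℚ (suc k !)                ≡⟨ /-*-denominator 1 (suc k !) {{suc k !≢0}} ⟩
    1ℚ                                        ∎
    where open ≡-Reasoning

expTerm : ℚ → ℕ → ℚ
expTerm x k = x ^ℚ k * 1/ k !

expTerm-nonNeg : ∀ {x} k → 0ℚ ≤ x → 0ℚ ≤ expTerm x k
expTerm-nonNeg k 0≤x = *-nonNeg (^ℚ-nonNeg k 0≤x) (ℚ.nonNegative⁻¹ _ {{ℚ.normalize-nonNeg 1 (k !) {{k !≢0}}}})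

expTerm-suc : ∀ x k → ℕ→ℚ (suc k) * expTerm x (suc k) ≡ x * expTerm x k
expTerm-suc x k = begin
  ℕ→ℚ (suc k) * (x * x ^ℚ k * 1/ suc k !)     ≡⟨ regroup (ℕ→ℚ (suc k)) x (x ^ℚ k) (1/ suc k !) ⟩
  x * (x ^ℚ k * (1/ suc k ! * ℕ→ℚ (suc k)))   ≡⟨ cong (λ r → x * (x ^ℚ k * r)) (1/!-suc k) ⟩
  x * (x ^ℚ k * 1/ k !)                       ∎
  where
  open ≡-Reasoning
  regroup : ∀ n x p r → n * (x * p * r) ≡ x * (p * (r * n))
  regroup = solve-∀ ℚ-ring

sumBelow : ℕ → (ℕ → ℚ) → ℚ
sumBelow zero    h = 0ℚ
sumBelow (suc K) h = h 0 + sumBelow K (λ k → h (suc k))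

sumBelow-suc : ∀ K h → sumBelow (suc K) h ≡ sumBelow K h + h K
sumBelow-suc zero    h = ℚ.+-comm (h 0) 0ℚ
sumBelow-suc (suc K) h = begin
  h 0 + sumBelow (suc K) (λ k → h (suc k))       ≡⟨ cong (_+_ (h 0)) (sumBelow-suc K (λ k → h (suc k))) ⟩
  h 0 + (sumBelow K (λ k → h (suc k)) + h (suc K)) ≡⟨ sym (ℚ.+-assoc (h 0) _ _) ⟩
  h 0 + sumBelow K (λ k → h (suc k)) + h (suc K)   ∎
  where open ≡-Reasoning

sumBelow-cong : ∀ K {h h′} → (∀ k → h k ≡ h′ k) → sumBelow K h ≡ sumBelow K h′
sumBelow-cong zero    _  = refl
sumBelow-cong (suc K) eq = cong₂ _+_ (eq 0) (sumBelow-cong K (λ k → eq (suc k)))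

sumBelow-+ : ∀ K h h′ → sumBelow K (λ k → h k + h′ k) ≡ sumBelow K h + sumBelow K h′
sumBelow-+ zero    h h′ = refl
sumBelow-+ (suc K) h h′ = begin
  h 0 + h′ 0 + sumBelow K (λ k → h (suc k) + h′ (suc k))  ≡⟨ cong (_+_ (h 0 + h′ 0)) (sumBelow-+ K _ _) ⟩
  h 0 + h′ 0 + (sumBelow K _ + sumBelow K _)              ≡⟨ +-Properties.interchange (h 0) (h′ 0) _ _ ⟩
  h 0 + sumBelow K _ + (h′ 0 + sumBelow K _)              ∎
  where open ≡-Reasoning

sumBelow-*ˡ : ∀ K c h → sumBelow K (λ k → c * h k) ≡ c * sumBelow K h
sumBelow-*ˡ zero    c h = sym (ℚ.*-zeroʳ c)
sumBelow-*ˡ (suc K) c h = trans (cong (_+_ (c * h 0)) (sumBelow-*ˡ K c _)) (sym (ℚ.*-distribˡ-+ c (h 0) _))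

sumBelow-nonNeg : ∀ K {h} → (∀ k → 0ℚ ≤ h k) → 0ℚ ≤ sumBelow K h
sumBelow-nonNeg zero    _   = ℚ.≤-refl
sumBelow-nonNeg (suc K) 0≤h = +-nonNeg (0≤h 0) (sumBelow-nonNeg K (λ k → 0≤h (suc k)))

sumBelow-≤-suc : ∀ K {h} → (∀ k → 0ℚ ≤ h k) → sumBelow K h ≤ sumBelow (suc K) h
sumBelow-≤-suc K {h} 0≤h = ℚ.≤-trans (p≤p+q (0≤h K)) (ℚ.≤-reflexive (sym (sumBelow-suc K h)))

expPartial≡sumBelow : ∀ x K → expPartial x K ≡ sumBelow K (expTerm x)
expPartial≡sumBelow x zero    = refl
expPartial≡sumBelow x (suc K) = trans (cong (_+ expTerm x K) (expPartial≡sumBelow x K)) (sym (sumBelow-suc K (expTerm x)))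

-- (f ⋆ g) k = Σ_{i+j=k} f i * g j
infixl 7 _⋆_
_⋆_ : (ℕ → ℚ) → (ℕ → ℚ) → ℕ → ℚ
(f ⋆ g) zero    = f 0 * g 0
(f ⋆ g) (suc k) = f 0 * g (suc k) + ((λ i → f (suc i)) ⋆ g) k

⋆-cong : ∀ {f f′ g g′} → (∀ i → f i ≡ f′ i) → (∀ j → g j ≡ g′ j) → ∀ k → (f ⋆ g) k ≡ (f′ ⋆ g′) k
⋆-cong f≗f′ g≗g′ zero    = cong₂ _*_ (f≗f′ 0) (g≗g′ 0)
⋆-cong f≗f′ g≗g′ (suc k) = cong₂ _+_ (cong₂ _*_ (f≗f′ 0) (g≗g′ (suc k))) (⋆-cong (λ i → f≗f′ (suc i)) g≗g′ k)

⋆-*ˡ : ∀ c f g k → ((λ i → c * f i) ⋆ g) k ≡ c * (f ⋆ g) k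
⋆-*ˡ c f g zero    = ℚ.*-assoc c (f 0) (g 0)
⋆-*ˡ c f g (suc k) = trans (cong₂ _+_ (ℚ.*-assoc c (f 0) (g (suc k))) (⋆-*ˡ c (λ i → f (suc i)) g k))
                           (sym (ℚ.*-distribˡ-+ c _ _))

⋆-*ʳ : ∀ c f g k → (f ⋆ (λ j → c * g j)) k ≡ c * (f ⋆ g) k
⋆-*ʳ c f g zero    = *-Properties.x∙yz≈y∙xz (f 0) c (g 0)
⋆-*ʳ c f g (suc k) = trans (cong₂ _+_ (*-Properties.x∙yz≈y∙xz (f 0) c (g (suc k))) (⋆-*ʳ c (λ i → f (suc i)) g k))
                           (sym (ℚ.*-distribˡ-+ c _ _))

⋆-+ˡ : ∀ f f′ g k → ((λ i → f i + f′ i) ⋆ g) k ≡ (f ⋆ g) k + (f′ ⋆ g) k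
⋆-+ˡ f f′ g zero    = ℚ.*-distribʳ-+ (g 0) (f 0) (f′ 0)
⋆-+ˡ f f′ g (suc k) = trans (cong₂ _+_ (ℚ.*-distribʳ-+ (g (suc k)) (f 0) (f′ 0)) (⋆-+ˡ _ _ g k))
                            (+-Properties.interchange (f 0 * g (suc k)) (f′ 0 * g (suc k)) _ _)

⋆-sucʳ : ∀ f g k → (f ⋆ g) (suc k) ≡ (f ⋆ (λ j → g (suc j))) k + f (suc k) * g 0
⋆-sucʳ f g zero    = refl
⋆-sucʳ f g (suc k) = trans (cong (_+_ (f 0 * g (suc (suc k)))) (⋆-sucʳ (λ i → f (suc i)) g k))
                           (sym (ℚ.+-assoc (f 0 * g (suc (suc k))) _ _))

⋆-leibniz : ∀ f g k → ((λ i → ℕ→ℚ i * f i) ⋆ g) k + (f ⋆ (λ j → ℕ→ℚ j * g j)) k ≡ ℕ→ℚ k * (f ⋆ g) k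
⋆-leibniz f g zero    = zero-weights (f 0) (g 0)
  where
  zero-weights : ∀ a b → 0ℚ * a * b + a * (0ℚ * b) ≡ 0ℚ * (a * b)
  zero-weights = solve-∀ ℚ-ring
⋆-leibniz f g (suc k) = begin
  0ℚ * f 0 * g (suc k) + ((λ i → ℕ→ℚ (suc i) * f′ i) ⋆ g) k + (f 0 * (n * g (suc k)) + C)
    ≡⟨ cong (λ x → 0ℚ * f 0 * g (suc k) + x + (f 0 * (n * g (suc k)) + C)) shifted ⟩
  0ℚ * f 0 * g (suc k) + (A + B) + (f 0 * (n * g (suc k)) + C)
    ≡⟨ regroup (f 0) (g (suc k)) n A B C ⟩
  n * (f 0 * g (suc k)) + (A + (B + C))
    ≡⟨ cong (λ x → n * (f 0 * g (suc k)) + (A + x)) (⋆-leibniz f′ g k) ⟩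
  n * (f 0 * g (suc k)) + (A + ℕ→ℚ k * A)
    ≡⟨ cong (_+_ (n * (f 0 * g (suc k)))) (sym (ℕ→ℚ-suc-* k A)) ⟩
  n * (f 0 * g (suc k)) + n * A
    ≡⟨ sym (ℚ.*-distribˡ-+ n (f 0 * g (suc k)) A) ⟩
  n * (f 0 * g (suc k) + A) ∎
  where
  open ≡-Reasoning
  n  = ℕ→ℚ (suc k)
  f′ = λ i → f (suc i)
  A = (f′ ⋆ g) k
  B = ((λ i → ℕ→ℚ i * f′ i) ⋆ g) k
  C = (f′ ⋆ (λ j → ℕ→ℚ j * g j)) k
  shifted : ((λ i → ℕ→ℚ (suc i) * f′ i) ⋆ g) k ≡ A + B
  shifted = trans (⋆-cong (λ i → ℕ→ℚ-suc-* i (f′ i)) (λ _ → refl) k) (⋆-+ˡ f′ (λ i → ℕ→ℚ i * f′ i) g k)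
  regroup : ∀ a b n A B C → 0ℚ * a * b + (A + B) + (a * (n * b) + C) ≡ n * (a * b) + (A + (B + C))
  regroup = solve-∀ ℚ-ring

-- Both sides F satisfy (k+1)·F(k+1) = (a+b)·F(k); on the right this is ⋆-leibniz.
expTerm-binomial : ∀ a b k → expTerm (a + b) k ≡ (expTerm a ⋆ expTerm b) k
expTerm-binomial a b zero    = refl
expTerm-binomial a b (suc k) = ℕ→ℚ-suc-*-cancelˡ k (begin
  n * expTerm (a + b) (suc k)                    ≡⟨ expTerm-suc (a + b) k ⟩
  (a + b) * expTerm (a + b) k                    ≡⟨ cong ((a + b) *_) (expTerm-binomial a b k) ⟩
  (a + b) * P                                 ≡⟨ ℚ.*-distribʳ-+ P a b ⟩
  a * P + b * P                               ≡⟨ sym (cong₂ _+_ weightedˡ weightedʳ) ⟩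
  ((λ i → ℕ→ℚ i * expTerm a i) ⋆ expTerm b) (suc k) + (expTerm a ⋆ (λ j → ℕ→ℚ j * expTerm b j)) (suc k)
                                              ≡⟨ ⋆-leibniz (expTerm a) (expTerm b) (suc k) ⟩
  n * (expTerm a ⋆ expTerm b) (suc k)               ∎)
  where
  open ≡-Reasoning
  n = ℕ→ℚ (suc k)
  P = (expTerm a ⋆ expTerm b) k
  weightedˡ : ((λ i → ℕ→ℚ i * expTerm a i) ⋆ expTerm b) (suc k) ≡ a * P
  weightedˡ = begin
    0ℚ * expTerm a 0 * expTerm b (suc k) + ((λ i → ℕ→ℚ (suc i) * expTerm a (suc i)) ⋆ expTerm b) k
      ≡⟨ cong (_+_ (0ℚ * expTerm a 0 * expTerm b (suc k))) (trans (⋆-cong (expTerm-suc a) (λ _ → refl) k) (⋆-*ˡ a (expTerm a) (expTerm b) k)) ⟩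
    0ℚ * expTerm a 0 * expTerm b (suc k) + a * P
      ≡⟨ drop-zero (expTerm a 0) (expTerm b (suc k)) (a * P) ⟩
    a * P ∎
    where
    drop-zero : ∀ x y z → 0ℚ * x * y + z ≡ z
    drop-zero = solve-∀ ℚ-ring
  weightedʳ : (expTerm a ⋆ (λ j → ℕ→ℚ j * expTerm b j)) (suc k) ≡ b * P
  weightedʳ = begin
    (expTerm a ⋆ (λ j → ℕ→ℚ j * expTerm b j)) (suc k)
      ≡⟨ ⋆-sucʳ (expTerm a) (λ j → ℕ→ℚ j * expTerm b j) k ⟩
    (expTerm a ⋆ (λ j → ℕ→ℚ (suc j) * expTerm b (suc j))) k + expTerm a (suc k) * (0ℚ * expTerm b 0)
      ≡⟨ cong (_+ expTerm a (suc k) * (0ℚ * expTerm b 0)) (trans (⋆-cong (λ _ → refl) (expTerm-suc b) k) (⋆-*ʳ b (expTerm a) (expTerm b) k)) ⟩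
    b * P + expTerm a (suc k) * (0ℚ * expTerm b 0)
      ≡⟨ drop-zero (b * P) (expTerm a (suc k)) (expTerm b 0) ⟩
    b * P ∎
    where
    drop-zero : ∀ z x y → z + x * (0ℚ * y) ≡ z
    drop-zero = solve-∀ ℚ-ring

⋆-sumBelow : ∀ K f g → (∀ i → 0ℚ ≤ f i) → (∀ j → 0ℚ ≤ g j) → sumBelow K (f ⋆ g) ≤ sumBelow K f * sumBelow K g
⋆-sumBelow zero    f g _   _   = ℚ.≤-refl
⋆-sumBelow (suc K) f g 0≤f 0≤g = begin
  f 0 * g 0 + sumBelow K (λ k → f 0 * g (suc k) + (f′ ⋆ g) k)
    ≡⟨ cong (_+_ (f 0 * g 0)) (trans (sumBelow-+ K _ (f′ ⋆ g)) (cong (_+ sumBelow K (f′ ⋆ g)) (sumBelow-*ˡ K (f 0) _))) ⟩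
  f 0 * g 0 + (f 0 * sumBelow K (λ k → g (suc k)) + sumBelow K (f′ ⋆ g))
    ≡⟨ sym (ℚ.+-assoc (f 0 * g 0) _ _) ⟩
  f 0 * g 0 + f 0 * sumBelow K (λ k → g (suc k)) + sumBelow K (f′ ⋆ g)
    ≡⟨ cong (_+ sumBelow K (f′ ⋆ g)) (sym (ℚ.*-distribˡ-+ (f 0) (g 0) _)) ⟩
  f 0 * G + sumBelow K (f′ ⋆ g)
    ≤⟨ ℚ.+-monoʳ-≤ (f 0 * G) (⋆-sumBelow K f′ g (λ i → 0≤f (suc i)) 0≤g) ⟩
  f 0 * G + sumBelow K f′ * sumBelow K g
    ≤⟨ ℚ.+-monoʳ-≤ (f 0 * G) (*-monoˡ-≤ (sumBelow-nonNeg K (λ i → 0≤f (suc i))) (sumBelow-≤-suc K 0≤g)) ⟩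
  f 0 * G + sumBelow K f′ * G
    ≡⟨ sym (ℚ.*-distribʳ-+ G (f 0) (sumBelow K f′)) ⟩
  (f 0 + sumBelow K f′) * G ∎
  where
  open ℚ.≤-Reasoning
  f′ = λ i → f (suc i)
  G = sumBelow (suc K) g

expPartial-+ : ∀ {a b} K → 0ℚ ≤ a → 0ℚ ≤ b → expPartial (a + b) K ≤ expPartial a K * expPartial b K
expPartial-+ {a} {b} K 0≤a 0≤b = begin
  expPartial (a + b) K                  ≡⟨ expPartial≡sumBelow (a + b) K ⟩
  sumBelow K (expTerm (a + b))             ≡⟨ sumBelow-cong K (expTerm-binomial a b) ⟩
  sumBelow K (expTerm a ⋆ expTerm b)          ≤⟨ ⋆-sumBelow K (expTerm a) (expTerm b) (λ i → expTerm-nonNeg i 0≤a) (λ j → expTerm-nonNeg j 0≤b) ⟩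
  sumBelow K (expTerm a) * sumBelow K (expTerm b)
                                        ≡⟨ sym (cong₂ _*_ (expPartial≡sumBelow a K) (expPartial≡sumBelow b K)) ⟩
  expPartial a K * expPartial b K       ∎
  where open ℚ.≤-Reasoning

expPartial-nonNeg : ∀ {x} K → 0ℚ ≤ x → 0ℚ ≤ expPartial x K
expPartial-nonNeg {x} K 0≤x =
  ℚ.≤-trans (sumBelow-nonNeg K (λ k → expTerm-nonNeg k 0≤x)) (ℚ.≤-reflexive (sym (expPartial≡sumBelow x K)))

expPartial-0 : ∀ K → expPartial 0ℚ K ≤ 1ℚ
expPartial-0 zero          = 0≤1
expPartial-0 (suc zero)    = ℚ.≤-refl
expPartial-0 (suc (suc K)) = ℚ.≤-trans (ℚ.≤-reflexive (drop-zero (expPartial 0ℚ (suc K)) (0ℚ ^ℚ K) (1/ suc K !))) (expPartial-0 (suc K))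
  where
  drop-zero : ∀ e p r → e + 0ℚ * p * r ≡ e
  drop-zero = solve-∀ ℚ-ring

expPartial-*ℕ : ∀ {y} n K → 0ℚ ≤ y → expPartial (ℕ→ℚ n * y) K ≤ expPartial y K ^ℚ n
expPartial-*ℕ {y} zero    K _   = ℚ.≤-trans (ℚ.≤-reflexive (cong (λ x → expPartial x K) (ℚ.*-zeroˡ y))) (expPartial-0 K)
expPartial-*ℕ {y} (suc n) K 0≤y = begin
  expPartial (ℕ→ℚ (suc n) * y) K             ≡⟨ cong (λ x → expPartial x K) (ℕ→ℚ-suc-* n y) ⟩
  expPartial (y + ℕ→ℚ n * y) K               ≤⟨ expPartial-+ K 0≤y (*-nonNeg (ℕ→ℚ-nonNeg n) 0≤y) ⟩
  expPartial y K * expPartial (ℕ→ℚ n * y) K  ≤⟨ *-monoˡ-≤ (expPartial-nonNeg K 0≤y) (expPartial-*ℕ n K 0≤y) ⟩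
  expPartial y K * expPartial y K ^ℚ n       ∎
  where open ℚ.≤-Reasoning

expTerm-halves : ∀ {y} k → 0ℚ ≤ y → y ≤ 1ℚ → ℕ→ℚ 2 * expTerm y (suc (suc k)) ≤ expTerm y (suc k)
expTerm-halves {y} k 0≤y y≤1 = *-cancelʳ-≤ (ℕ→ℚ-pos (suc k)) (begin
  ℕ→ℚ 2 * expTerm y (2 ℕ.+ k) * ℕ→ℚ (2 ℕ.+ k)      ≡⟨ *-Properties.xy∙z≈x∙zy (ℕ→ℚ 2) (expTerm y (2 ℕ.+ k)) (ℕ→ℚ (2 ℕ.+ k)) ⟩
  ℕ→ℚ 2 * (ℕ→ℚ (2 ℕ.+ k) * expTerm y (2 ℕ.+ k))    ≡⟨ cong (ℕ→ℚ 2 *_) (expTerm-suc y (suc k)) ⟩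
  ℕ→ℚ 2 * (y * expTerm y (suc k))                  ≤⟨ *-monoˡ-≤ (ℕ→ℚ-nonNeg 2) (*-monoʳ-≤ (expTerm-nonNeg (suc k) 0≤y) y≤1) ⟩
  ℕ→ℚ 2 * (1ℚ * expTerm y (suc k))                 ≡⟨ cong (ℕ→ℚ 2 *_) (ℚ.*-identityˡ (expTerm y (suc k))) ⟩
  ℕ→ℚ 2 * expTerm y (suc k)                        ≡⟨ ℚ.*-comm (ℕ→ℚ 2) (expTerm y (suc k)) ⟩
  expTerm y (suc k) * ℕ→ℚ 2                        ≤⟨ *-monoˡ-≤ (expTerm-nonNeg (suc k) 0≤y) (ℕ→ℚ-mono-≤ (ℕ.m≤m+n 2 k)) ⟩
  expTerm y (suc k) * ℕ→ℚ (2 ℕ.+ k)                ∎)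
  where open ℚ.≤-Reasoning

expPartial≤1+2y : ∀ {y} K → 0ℚ ≤ y → y ≤ 1ℚ → expPartial y K ≤ 1ℚ + ℕ→ℚ 2 * y
expPartial≤1+2y zero    0≤y _   = +-nonNeg 0≤1 (*-nonNeg (ℕ→ℚ-nonNeg 2) 0≤y)
expPartial≤1+2y {y} (suc K) 0≤y y≤1 =
  ℚ.≤-trans (p≤p+q (*-nonNeg (ℕ→ℚ-nonNeg 2) (expTerm-nonNeg (suc K) 0≤y))) (invariant K)
  where
  invariant : ∀ K → expPartial y (suc K) + ℕ→ℚ 2 * expTerm y (suc K) ≤ 1ℚ + ℕ→ℚ 2 * y
  invariant zero    = ℚ.≤-reflexive (first-terms y)
    where
    first-terms : ∀ y → 0ℚ + 1ℚ * 1/ 0 ! + ℕ→ℚ 2 * (y * 1ℚ * 1/ 1 !) ≡ 1ℚ + ℕ→ℚ 2 * y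
    first-terms = solve-∀ ℚ-ring
  invariant (suc K) = ℚ.≤-trans (begin
    expPartial y (suc K) + expTerm y (suc K) + ℕ→ℚ 2 * expTerm y (2 ℕ.+ K)
      ≤⟨ ℚ.+-monoʳ-≤ (expPartial y (suc K) + expTerm y (suc K)) (expTerm-halves K 0≤y y≤1) ⟩
    expPartial y (suc K) + expTerm y (suc K) + expTerm y (suc K)
      ≡⟨ double (expPartial y (suc K)) (expTerm y (suc K)) ⟩
    expPartial y (suc K) + ℕ→ℚ 2 * expTerm y (suc K) ∎) (invariant K)
    where
    open ℚ.≤-Reasoning
    double : ∀ e t → e + t + t ≡ e + ℕ→ℚ 2 * t
    double = solve-∀ ℚ-ring

1+ks≤[1+s]^k : ∀ k {s} → 0ℚ ≤ s → 1ℚ + ℕ→ℚ k * s ≤ (1ℚ + s) ^ℚ k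
1+ks≤[1+s]^k zero    {s} _   = ℚ.≤-reflexive (trans (cong (_+_ 1ℚ) (ℚ.*-zeroˡ s)) (ℚ.+-identityʳ 1ℚ))
1+ks≤[1+s]^k (suc k) {s} 0≤s = begin
  1ℚ + ℕ→ℚ (suc k) * s                       ≡⟨ cong (_+_ 1ℚ) (ℕ→ℚ-suc-* k s) ⟩
  1ℚ + (s + ℕ→ℚ k * s)                       ≤⟨ p≤p+q (*-nonNeg (ℕ→ℚ-nonNeg k) (*-nonNeg 0≤s 0≤s)) ⟩
  1ℚ + (s + ℕ→ℚ k * s) + ℕ→ℚ k * (s * s)     ≡⟨ factor (ℕ→ℚ k) s ⟩
  (1ℚ + s) * (1ℚ + ℕ→ℚ k * s)                ≤⟨ *-monoˡ-≤ (+-nonNeg 0≤1 0≤s) (1+ks≤[1+s]^k k 0≤s) ⟩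
  (1ℚ + s) * (1ℚ + s) ^ℚ k                   ∎
  where
  open ℚ.≤-Reasoning
  factor : ∀ k s → 1ℚ + (s + k * s) + k * (s * s) ≡ (1ℚ + s) * (1ℚ + k * s)
  factor = solve-∀ ℚ-ring

[1+s]^k≤1+ks+[ks]² : ∀ k {s} → 0ℚ ≤ s → ℕ→ℚ k * s ≤ 1ℚ → (1ℚ + s) ^ℚ k ≤ 1ℚ + ℕ→ℚ k * s + (ℕ→ℚ k * s) * (ℕ→ℚ k * s)
[1+s]^k≤1+ks+[ks]² zero    {s} _   _    = ℚ.≤-reflexive (expand s)
  where
  expand : ∀ s → 1ℚ ≡ 1ℚ + 0ℚ * s + (0ℚ * s) * (0ℚ * s)
  expand = solve-∀ ℚ-ring
[1+s]^k≤1+ks+[ks]² (suc k) {s} 0≤s ks≤1 = begin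
  (1ℚ + s) * (1ℚ + s) ^ℚ k
    ≤⟨ *-monoˡ-≤ (+-nonNeg 0≤1 0≤s) ([1+s]^k≤1+ks+[ks]² k 0≤s as≤1) ⟩
  (1ℚ + s) * (1ℚ + a * s + (a * s) * (a * s))
    ≤⟨ p≤p+q (*-nonNeg (*-nonNeg 0≤s 0≤s) (+-nonNeg 0≤1 (*-nonNeg (ℕ→ℚ-nonNeg k) 0≤1-as))) ⟩
  (1ℚ + s) * (1ℚ + a * s + (a * s) * (a * s)) + (s * s) * (1ℚ + a * (1ℚ - a * s))
    ≡⟨ expand a s ⟩
  1ℚ + (1ℚ + a) * s + ((1ℚ + a) * s) * ((1ℚ + a) * s)
    ≡⟨ cong (λ b → 1ℚ + b * s + (b * s) * (b * s)) (sym (ℕ→ℚ-suc k)) ⟩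
  1ℚ + ℕ→ℚ (suc k) * s + (ℕ→ℚ (suc k) * s) * (ℕ→ℚ (suc k) * s) ∎
  where
  open ℚ.≤-Reasoning
  a = ℕ→ℚ k
  as≤1 : a * s ≤ 1ℚ
  as≤1 = ℚ.≤-trans (*-monoʳ-≤ 0≤s (ℕ→ℚ-mono-≤ (ℕ.n≤1+n k))) ks≤1
  0≤1-as : 0ℚ ≤ 1ℚ - a * s
  0≤1-as = ℚ.≤-trans (ℚ.≤-reflexive (sym (ℚ.+-inverseʳ (a * s)))) (ℚ.+-monoˡ-≤ (ℚ.- (a * s)) as≤1)
  expand : ∀ a s → (1ℚ + s) * (1ℚ + a * s + (a * s) * (a * s)) + (s * s) * (1ℚ + a * (1ℚ - a * s))
                  ≡ 1ℚ + (1ℚ + a) * s + ((1ℚ + a) * s) * ((1ℚ + a) * s)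
  expand = solve-∀ ℚ-ring

f+a[1+t+t²]≤3[f+a] : ∀ {a f t} → 0ℚ ≤ a → 0ℚ ≤ f → 0ℚ ≤ t → t ≤ 1ℚ → f + a * (1ℚ + t + t * t) ≤ ℕ→ℚ 3 * (f + a)
f+a[1+t+t²]≤3[f+a] {a} {f} {t} 0≤a 0≤f 0≤t t≤1 = begin
  f + a * (1ℚ + t + t * t)              ≤⟨ ℚ.+-monoʳ-≤ f (*-monoˡ-≤ 0≤a 1+t+t²≤3) ⟩
  f + a * ℕ→ℚ 3                         ≤⟨ p≤p+q (*-nonNeg (ℕ→ℚ-nonNeg 2) 0≤f) ⟩
  f + a * ℕ→ℚ 3 + ℕ→ℚ 2 * f             ≡⟨ regroup f a ⟩
  ℕ→ℚ 3 * (f + a)                       ∎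
  where
  open ℚ.≤-Reasoning
  t²≤1 : t * t ≤ 1ℚ
  t²≤1 = ℚ.≤-trans (*-monoʳ-≤ 0≤t t≤1) (ℚ.≤-trans (ℚ.≤-reflexive (ℚ.*-identityˡ t)) t≤1)
  1+t+t²≤3 : 1ℚ + t + t * t ≤ ℕ→ℚ 3
  1+t+t²≤3 = ℚ.+-mono-≤ (ℚ.+-monoʳ-≤ 1ℚ t≤1) t²≤1
  regroup : ∀ f a → f + a * ℕ→ℚ 3 + ℕ→ℚ 2 * f ≡ ℕ→ℚ 3 * (f + a)
  regroup = solve-∀ ℚ-ring

mgf-bound : ∀ {a f t y w} → 0ℚ ≤ a → 0ℚ ≤ f → 0ℚ ≤ t → t ≤ 1ℚ → 0ℚ ≤ y → ℕ→ℚ 6 * y ≤ t * t →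
            w ≤ 1ℚ + t + t * t →
            (1ℚ + ℕ→ℚ 2 * y) * (f + a * w) ≤ (f + a) + a * t + ℕ→ℚ 2 * (f + a) * (t * t)
mgf-bound {a} {f} {t} {y} {w} 0≤a 0≤f 0≤t t≤1 0≤y 6y≤t² w≤1+t+t² = begin
  (1ℚ + ℕ→ℚ 2 * y) * (f + a * w)    ≤⟨ *-monoˡ-≤ (+-nonNeg 0≤1 0≤2y) (ℚ.+-monoʳ-≤ f (*-monoˡ-≤ 0≤a w≤1+t+t²)) ⟩
  (1ℚ + ℕ→ℚ 2 * y) * S              ≡⟨ distrib y S ⟩
  S + ℕ→ℚ 2 * y * S                 ≤⟨ ℚ.+-monoʳ-≤ S (*-monoˡ-≤ 0≤2y (f+a[1+t+t²]≤3[f+a] 0≤a 0≤f 0≤t t≤1)) ⟩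
  S + ℕ→ℚ 2 * y * (ℕ→ℚ 3 * X)       ≡⟨ cong (_+_ S) (rearrange y X) ⟩
  S + X * (ℕ→ℚ 6 * y)               ≤⟨ ℚ.+-monoʳ-≤ S (*-monoˡ-≤ (+-nonNeg 0≤f 0≤a) 6y≤t²) ⟩
  S + X * (t * t)                   ≡⟨ expand a f t ⟩
  X + a * t + a * (t * t) + X * (t * t)
                                    ≤⟨ ℚ.+-monoˡ-≤ (X * (t * t)) (ℚ.+-monoʳ-≤ (X + a * t) (*-monoʳ-≤ (*-nonNeg 0≤t 0≤t) (q≤p+q 0≤f))) ⟩
  X + a * t + X * (t * t) + X * (t * t)
                                    ≡⟨ double X (a * t) (t * t) ⟩
  X + a * t + ℕ→ℚ 2 * X * (t * t)   ∎
  where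
  open ℚ.≤-Reasoning
  X = f + a
  S = f + a * (1ℚ + t + t * t)
  0≤2y = *-nonNeg (ℕ→ℚ-nonNeg 2) 0≤y
  distrib : ∀ y S → (1ℚ + ℕ→ℚ 2 * y) * S ≡ S + ℕ→ℚ 2 * y * S
  distrib = solve-∀ ℚ-ring
  rearrange : ∀ y X → ℕ→ℚ 2 * y * (ℕ→ℚ 3 * X) ≡ X * (ℕ→ℚ 6 * y)
  rearrange = solve-∀ ℚ-ring
  expand : ∀ a f t → f + a * (1ℚ + t + t * t) + (f + a) * (t * t) ≡ f + a + a * t + a * (t * t) + (f + a) * (t * t)
  expand = solve-∀ ℚ-ring
  double : ∀ X p q → X + p + X * q + X * q ≡ X + p + ℕ→ℚ 2 * X * q
  double = solve-∀ ℚ-ring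

-- Digit counts in blocks

module _ {A : Set} where

  sumℚ : (A → ℚ) → List A → ℚ
  sumℚ h []       = 0ℚ
  sumℚ h (x ∷ xs) = h x + sumℚ h xs

  sumℚ-++ : ∀ h xs ys → sumℚ h (xs ++ ys) ≡ sumℚ h xs + sumℚ h ys
  sumℚ-++ h []       ys = sym (ℚ.+-identityˡ (sumℚ h ys))
  sumℚ-++ h (x ∷ xs) ys = trans (cong (_+_ (h x)) (sumℚ-++ h xs ys)) (sym (ℚ.+-assoc (h x) _ _))

  sumℚ-cong : ∀ {h h′} xs → (∀ x → h x ≡ h′ x) → sumℚ h xs ≡ sumℚ h′ xs
  sumℚ-cong []       _    = refl
  sumℚ-cong (x ∷ xs) h≗h′ = cong₂ _+_ (h≗h′ x) (sumℚ-cong xs h≗h′)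

  sumℚ-*ˡ : ∀ c h xs → sumℚ (λ x → c * h x) xs ≡ c * sumℚ h xs
  sumℚ-*ˡ c h []       = sym (ℚ.*-zeroʳ c)
  sumℚ-*ˡ c h (x ∷ xs) = trans (cong (_+_ (c * h x)) (sumℚ-*ˡ c h xs)) (sym (ℚ.*-distribˡ-+ c (h x) _))

  sumℚ-+ : ∀ h h′ xs → sumℚ (λ x → h x + h′ x) xs ≡ sumℚ h xs + sumℚ h′ xs
  sumℚ-+ h h′ []       = refl
  sumℚ-+ h h′ (x ∷ xs) = trans (cong (_+_ (h x + h′ x)) (sumℚ-+ h h′ xs)) (+-Properties.interchange (h x) (h′ x) _ _)

sumℚ-map : ∀ {A B : Set} (h : B → ℚ) (f : A → B) xs → sumℚ h (map f xs) ≡ sumℚ (λ x → h (f x)) xs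
sumℚ-map h f []       = refl
sumℚ-map h f (x ∷ xs) = cong (_+_ (h (f x))) (sumℚ-map h f xs)

sumℚ-concatMap : ∀ {A B : Set} (h : B → ℚ) (f : A → List B) xs →
                 sumℚ h (concatMap f xs) ≡ sumℚ (λ x → sumℚ h (f x)) xs
sumℚ-concatMap h f []       = refl
sumℚ-concatMap h f (x ∷ xs) = trans (sumℚ-++ h (f x) (concatMap f xs)) (cong (_+_ (sumℚ h (f x))) (sumℚ-concatMap h f xs))

sumℚ-tabulate-const : ∀ {B : Set} m (f : Fin m → B) (h : B → ℚ) {c} → (∀ i → h (f i) ≡ c) →
                      sumℚ h (tabulate f) ≡ ℕ→ℚ m * c
sumℚ-tabulate-const zero    f h {c} _     = sym (ℚ.*-zeroˡ c)
sumℚ-tabulate-const (suc m) f h {c} hf≡c = begin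
  h (f fzero) + sumℚ h (tabulate (λ i → f (fsuc i)))  ≡⟨ cong₂ _+_ (hf≡c fzero) (sumℚ-tabulate-const m _ h (λ i → hf≡c (fsuc i))) ⟩
  c + ℕ→ℚ m * c                                       ≡⟨ sym (ℕ→ℚ-suc-* m c) ⟩
  ℕ→ℚ (suc m) * c                                     ∎
  where open ≡-Reasoning

nonzeros : ∀ {b n} → Vec (Fin b) n → ℕ
nonzeros []            = 0
nonzeros (fzero  ∷ xs) = nonzeros xs
nonzeros (fsuc _ ∷ xs) = suc (nonzeros xs)

zeros+nonzeros : ∀ {b n} (v : Vec (Fin b) n) → zeros v ℕ.+ nonzeros v ≡ n
zeros+nonzeros []            = refl
zeros+nonzeros (fzero  ∷ xs) = cong suc (zeros+nonzeros xs)
zeros+nonzeros (fsuc _ ∷ xs) = trans (ℕ.+-suc (zeros xs) (nonzeros xs)) (cong suc (zeros+nonzeros xs))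

digitWeight : ∀ {b} → ℚ → ℚ → Fin b → ℚ
digitWeight A B fzero    = A
digitWeight A B (fsuc _) = B

blockWeight : ∀ {b n} → ℚ → ℚ → Vec (Fin b) n → ℚ
blockWeight A B v = A ^ℚ zeros v * B ^ℚ nonzeros v

blockWeight-nonNeg : ∀ {b n A B} → 0ℚ ≤ A → 0ℚ ≤ B → (v : Vec (Fin b) n) → 0ℚ ≤ blockWeight A B v
blockWeight-nonNeg 0≤A 0≤B v = *-nonNeg (^ℚ-nonNeg (zeros v) 0≤A) (^ℚ-nonNeg (nonzeros v) 0≤B)

blockWeight-∷ : ∀ {b n} A B x (v : Vec (Fin b) n) → blockWeight A B (x ∷ v) ≡ digitWeight A B x * blockWeight A B v
blockWeight-∷ A B fzero    v = ℚ.*-assoc A (A ^ℚ zeros v) (B ^ℚ nonzeros v)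
blockWeight-∷ A B (fsuc _) v = *-Properties.x∙yz≈y∙xz (A ^ℚ zeros v) B (B ^ℚ nonzeros v)

sumℚ-blockWeight : ∀ m n A B → sumℚ (blockWeight A B) (blocks (suc m) n) ≡ (A + ℕ→ℚ m * B) ^ℚ n
sumℚ-blockWeight m zero    A B = refl
sumℚ-blockWeight m (suc n) A B = begin
  sumℚ (blockWeight A B) (concatMap (λ x → map (x ∷_) Bs) (allFin (suc m)))
    ≡⟨ sumℚ-concatMap (blockWeight A B) (λ x → map (x ∷_) Bs) (allFin (suc m)) ⟩
  sumℚ (λ x → sumℚ (blockWeight A B) (map (x ∷_) Bs)) (allFin (suc m))
    ≡⟨ sumℚ-cong (allFin (suc m)) extend ⟩
  sumℚ (λ x → digitWeight A B x * S) (allFin (suc m))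
    ≡⟨ cong (_+_ (A * S)) (sumℚ-tabulate-const m fsuc (λ x → digitWeight A B x * S) (λ _ → refl)) ⟩
  A * S + ℕ→ℚ m * (B * S)
    ≡⟨ factor A B (ℕ→ℚ m) S ⟩
  (A + ℕ→ℚ m * B) * S
    ≡⟨ cong ((A + ℕ→ℚ m * B) *_) (sumℚ-blockWeight m n A B) ⟩
  (A + ℕ→ℚ m * B) * (A + ℕ→ℚ m * B) ^ℚ n ∎
  where
  open ≡-Reasoning
  Bs = blocks (suc m) n
  S = sumℚ (blockWeight A B) Bs
  extend : ∀ x → sumℚ (blockWeight A B) (map (x ∷_) Bs) ≡ digitWeight A B x * S
  extend x = begin
    sumℚ (blockWeight A B) (map (x ∷_) Bs)            ≡⟨ sumℚ-map (blockWeight A B) (x ∷_) Bs ⟩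
    sumℚ (λ v → blockWeight A B (x ∷ v)) Bs           ≡⟨ sumℚ-cong Bs (blockWeight-∷ A B x) ⟩
    sumℚ (λ v → digitWeight A B x * blockWeight A B v) Bs ≡⟨ sumℚ-*ˡ (digitWeight A B x) (blockWeight A B) Bs ⟩
    digitWeight A B x * S                             ∎
  factor : ∀ A B m S → A * S + m * (B * S) ≡ (A + m * B) * S
  factor = solve-∀ ℚ-ring

count-unique : ∀ x {J} → Unique J → length (filter (x ℕ.≟_) J) ≡ 0 ⊎ (length (filter (x ℕ.≟_) J) ≡ 1 × x ∈ J)
count-unique x {[]}    _             = inj₁ refl
count-unique x {j ∷ J} (j∉J ∷ uniq) with x ℕ.≟ j
... | yes x≡j = inj₂ (trans (cong length (filter-accept (x ℕ.≟_) x≡j)) (cong (suc ∘ length) (filter-none (x ℕ.≟_) x∉J)) , here x≡j)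
  where
  x∉J : All (x ≢_) J
  x∉J = All.map (λ j≢k x≡k → j≢k (trans (sym x≡j) x≡k)) j∉J
... | no  x≢j with count-unique x uniq
...   | inj₁ c≡0         = inj₁ (trans (cong length (filter-reject (x ℕ.≟_) x≢j)) c≡0)
...   | inj₂ (c≡1 , x∈J) = inj₂ (trans (cong length (filter-reject (x ℕ.≟_) x≢j)) c≡1 , there x∈J)

module _ {V : Set} (z : V → ℕ) where

  count : List V → ℕ → ℕ
  count Vs j = length (filter (λ v → z v ℕ.≟ j) Vs)

  sum-count-∷ : ∀ v Vs J → sum (map (count (v ∷ Vs)) J) ≡ length (filter (z v ℕ.≟_) J) ℕ.+ sum (map (count Vs) J)
  sum-count-∷ v Vs []      = refl
  sum-count-∷ v Vs (j ∷ J) with z v ℕ.≟ j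
  ... | yes zv≡j = begin
    count (v ∷ Vs) j ℕ.+ sum (map (count (v ∷ Vs)) J)          ≡⟨ cong₂ ℕ._+_ (cong length (filter-accept (λ w → z w ℕ.≟ j) zv≡j)) (sum-count-∷ v Vs J) ⟩
    suc (count Vs j ℕ.+ (hits J ℕ.+ sum (map (count Vs) J)))   ≡⟨ cong suc (ℕ+-Properties.x∙yz≈y∙xz (count Vs j) (hits J) _) ⟩
    suc (hits J ℕ.+ (count Vs j ℕ.+ sum (map (count Vs) J)))   ≡⟨ cong (λ c → length c ℕ.+ _) (sym (filter-accept (z v ℕ.≟_) zv≡j)) ⟩
    hits (j ∷ J) ℕ.+ (count Vs j ℕ.+ sum (map (count Vs) J))   ∎
    where
    open ≡-Reasoning
    hits = λ J → length (filter (z v ℕ.≟_) J)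
  ... | no  zv≢j = begin
    count (v ∷ Vs) j ℕ.+ sum (map (count (v ∷ Vs)) J)          ≡⟨ cong₂ ℕ._+_ (cong length (filter-reject (λ w → z w ℕ.≟ j) zv≢j)) (sum-count-∷ v Vs J) ⟩
    count Vs j ℕ.+ (hits J ℕ.+ sum (map (count Vs) J))         ≡⟨ ℕ+-Properties.x∙yz≈y∙xz (count Vs j) (hits J) _ ⟩
    hits J ℕ.+ (count Vs j ℕ.+ sum (map (count Vs) J))         ≡⟨ cong (λ c → length c ℕ.+ _) (sym (filter-reject (z v ℕ.≟_) zv≢j)) ⟩
    hits (j ∷ J) ℕ.+ (count Vs j ℕ.+ sum (map (count Vs) J))   ∎
    where
    open ≡-Reasoning
    hits = λ J → length (filter (z v ℕ.≟_) J)

  markov : ∀ (h : V → ℚ) {J M} → Unique J → (∀ v → 0ℚ ≤ h v) → (∀ v → z v ∈ J → M ≤ h v) →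
           ∀ Vs → ℕ→ℚ (sum (map (count Vs) J)) * M ≤ sumℚ h Vs
  markov h {J} {M} uniq 0≤h M≤h []       = ℚ.≤-reflexive (trans (cong (λ c → ℕ→ℚ c * M) (sum-zeros J)) (ℚ.*-zeroˡ M))
    where
    sum-zeros : ∀ J → sum (map (count []) J) ≡ 0
    sum-zeros []      = refl
    sum-zeros (_ ∷ J) = sum-zeros J
  markov h {J} {M} uniq 0≤h M≤h (v ∷ Vs) = begin
    ℕ→ℚ (sum (map (count (v ∷ Vs)) J)) * M                   ≡⟨ cong (λ c → ℕ→ℚ c * M) (sum-count-∷ v Vs J) ⟩
    ℕ→ℚ (hits ℕ.+ sum (map (count Vs) J)) * M                ≡⟨ cong (_* M) (ℕ→ℚ-homo-+ hits _) ⟩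
    (ℕ→ℚ hits + ℕ→ℚ (sum (map (count Vs) J))) * M            ≡⟨ ℚ.*-distribʳ-+ M (ℕ→ℚ hits) _ ⟩
    ℕ→ℚ hits * M + ℕ→ℚ (sum (map (count Vs) J)) * M          ≤⟨ ℚ.+-mono-≤ hits*M≤h (markov h uniq 0≤h M≤h Vs) ⟩
    h v + sumℚ h Vs                                          ∎
    where
    open ℚ.≤-Reasoning
    hits = length (filter (z v ℕ.≟_) J)
    hits*M≤h : ℕ→ℚ hits * M ≤ h v
    hits*M≤h with count-unique (z v) uniq
    ... | inj₁ hits≡0          = ℚ.≤-trans (ℚ.≤-reflexive (trans (cong (λ c → ℕ→ℚ c * M) hits≡0) (ℚ.*-zeroˡ M))) (0≤h v)
    ... | inj₂ (hits≡1 , zv∈J) = ℚ.≤-trans (ℚ.≤-reflexive (trans (cong (λ c → ℕ→ℚ c * M) hits≡1) (ℚ.*-identityˡ M))) (M≤h v zv∈J)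

-- The Chernoff bound

scaled-threshold : ∀ {θ} L c {n j} → θ * ℕ→ℚ L ≡ ℕ→ℚ c → θ * ℕ→ℚ n ≤ ℕ→ℚ j → c ℕ.* n ℕ.≤ L ℕ.* j
scaled-threshold {θ} L c {n} {j} θL≡c θn≤j = ℕ→ℚ-cancel-≤ (begin
  ℕ→ℚ (c ℕ.* n)          ≡⟨ ℕ→ℚ-homo-* c n ⟩
  ℕ→ℚ c * ℕ→ℚ n          ≡⟨ cong (_* ℕ→ℚ n) (sym θL≡c) ⟩
  θ * ℕ→ℚ L * ℕ→ℚ n      ≡⟨ *-Properties.xy∙z≈y∙xz θ (ℕ→ℚ L) (ℕ→ℚ n) ⟩
  ℕ→ℚ L * (θ * ℕ→ℚ n)    ≤⟨ *-monoˡ-≤ (ℕ→ℚ-nonNeg L) θn≤j ⟩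
  ℕ→ℚ L * ℕ→ℚ j          ≡⟨ sym (ℕ→ℚ-homo-* L j) ⟩
  ℕ→ℚ (L ℕ.* j)          ∎)
  where open ℚ.≤-Reasoning

-- For a digit class of relative size a/b, θ a = a/b + ε is the tail threshold and c a = θ a · L
-- its integer rescaling. The upper tail counts the digit 0 (a = 1), the lower tail the nonzero
-- digits (a = m).
module Chernoff (m n : ℕ) {ε : ℚ} (0≤ε : 0ℚ ≤ ε) (ε≤1 : ε ≤ 1ℚ) where

  b e₁ e₂ L : ℕ
  b  = suc m
  e₁ = ℤ.∣ ℚ.↥ ε ∣
  e₂ = ℚ.↧ₙ ε
  L  = b ℕ.* e₂

  X t s u y R : ℚ
  X = ℕ→ℚ b
  t = ε * recip 2
  s = t * recip L
  u = 1ℚ + s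
  y = ε * ε * recip 80
  R = 1ℚ + ℕ→ℚ 2 * y

  θ : ℕ → ℚ
  θ a = ℕ→ℚ a * recip b + ε

  c : ℕ → ℕ
  c a = a ℕ.* e₂ ℕ.+ b ℕ.* e₁

  θ*L≡c : ∀ a → θ a * ℕ→ℚ L ≡ ℕ→ℚ (c a)
  θ*L≡c a = begin
    (ℕ→ℚ a * recip b + ε) * ℕ→ℚ (b ℕ.* e₂)              ≡⟨ cong ((ℕ→ℚ a * recip b + ε) *_) (ℕ→ℚ-homo-* b e₂) ⟩
    (ℕ→ℚ a * recip b + ε) * (X * ℕ→ℚ e₂)                ≡⟨ expand (ℕ→ℚ a) (recip b) ε X (ℕ→ℚ e₂) ⟩
    ℕ→ℚ a * ℕ→ℚ e₂ * (recip b * X) + X * (ε * ℕ→ℚ e₂)   ≡⟨ cong₂ (λ p q → ℕ→ℚ a * ℕ→ℚ e₂ * p + X * q) (recip-* m) (*-↧ₙ≡∣↥∣ ε 0≤ε) ⟩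
    ℕ→ℚ a * ℕ→ℚ e₂ * 1ℚ + X * ℕ→ℚ e₁                    ≡⟨ cong (_+ X * ℕ→ℚ e₁) (ℚ.*-identityʳ (ℕ→ℚ a * ℕ→ℚ e₂)) ⟩
    ℕ→ℚ a * ℕ→ℚ e₂ + X * ℕ→ℚ e₁                         ≡⟨ sym (cong₂ _+_ (ℕ→ℚ-homo-* a e₂) (ℕ→ℚ-homo-* b e₁)) ⟩
    ℕ→ℚ (a ℕ.* e₂) + ℕ→ℚ (b ℕ.* e₁)                     ≡⟨ sym (ℕ→ℚ-homo-+ (a ℕ.* e₂) (b ℕ.* e₁)) ⟩
    ℕ→ℚ (c a)                                           ∎
    where
    open ≡-Reasoning
    expand : ∀ a r ε X e → (a * r + ε) * (X * e) ≡ a * e * (r * X) + X * (ε * e)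
    expand = solve-∀ ℚ-ring

  L*s≡t : ℕ→ℚ L * s ≡ t
  L*s≡t = begin
    ℕ→ℚ L * (t * recip L)       ≡⟨ *-Properties.x∙yz≈y∙zx (ℕ→ℚ L) t (recip L) ⟩
    t * (recip L * ℕ→ℚ L)       ≡⟨ cong (t *_) (recip-* (ℚ.denominator-1 ε ℕ.+ m ℕ.* e₂)) ⟩
    t * 1ℚ                      ≡⟨ ℚ.*-identityʳ t ⟩
    t                           ∎
    where open ≡-Reasoning

  0≤t : 0ℚ ≤ t
  0≤t = *-nonNeg 0≤ε (recip-nonNeg 2)

  t≤1 : t ≤ 1ℚ
  t≤1 = ℚ.≤-trans (*-monoʳ-≤ (recip-nonNeg 2) ε≤1) (ℚ.*≤* (ℤ.+≤+ (ℕ.s≤s ℕ.z≤n)))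

  0≤s : 0ℚ ≤ s
  0≤s = *-nonNeg 0≤t (recip-nonNeg L)

  0≤y : 0ℚ ≤ y
  0≤y = *-nonNeg (*-nonNeg 0≤ε 0≤ε) (recip-nonNeg 80)

  y≤1 : y ≤ 1ℚ
  y≤1 = ℚ.≤-trans (*-monoʳ-≤ (recip-nonNeg 80) (*-mono-≤ 0≤ε 0≤ε ε≤1 ε≤1)) (ℚ.*≤* (ℤ.+≤+ (ℕ.s≤s ℕ.z≤n)))

  6y≤t² : ℕ→ℚ 6 * y ≤ t * t
  6y≤t² = begin
    ℕ→ℚ 6 * y     ≤⟨ *-monoʳ-≤ 0≤y (ℕ→ℚ-mono-≤ (ℕ.m≤m+n 6 14)) ⟩
    ℕ→ℚ 20 * y    ≡⟨ 20y≡t² ε ⟩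
    t * t         ∎
    where
    open ℚ.≤-Reasoning
    20y≡t² : ∀ ε → ℕ→ℚ 20 * (ε * ε * recip 80) ≡ ε * recip 2 * (ε * recip 2)
    20y≡t² = solve-∀ ℚ-ring

  w : ℚ
  w = u ^ℚ L

  1≤u : 1ℚ ≤ u
  1≤u = p≤p+q 0≤s

  0≤u : 0ℚ ≤ u
  0≤u = ℚ.≤-trans 0≤1 1≤u

  0≤w : 0ℚ ≤ w
  0≤w = ^ℚ-nonNeg L 0≤u

  0≤R : 0ℚ ≤ R
  0≤R = +-nonNeg 0≤1 (*-nonNeg (ℕ→ℚ-nonNeg 2) 0≤y)

  w≤1+t+t² : w ≤ 1ℚ + t + t * t
  w≤1+t+t² = subst (λ q → w ≤ 1ℚ + q + q * q) L*s≡t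
    ([1+s]^k≤1+ks+[ks]² L 0≤s (ℚ.≤-trans (ℚ.≤-reflexive L*s≡t) t≤1))

  X*c*s≡at+2Xt² : ∀ a → X * ℕ→ℚ (c a) * s ≡ ℕ→ℚ a * t + ℕ→ℚ 2 * X * (t * t)
  X*c*s≡at+2Xt² a = begin
    X * ℕ→ℚ (c a) * s                                  ≡⟨ cong (λ q → X * q * s) (sym (θ*L≡c a)) ⟩
    X * (θ a * ℕ→ℚ L) * s                              ≡⟨ reassociate X (θ a) (ℕ→ℚ L) s ⟩
    X * θ a * (ℕ→ℚ L * s)                              ≡⟨ cong (X * θ a *_) L*s≡t ⟩
    X * (ℕ→ℚ a * recip b + ε) * t                      ≡⟨ expand X (ℕ→ℚ a) (recip b) ε ⟩
    ℕ→ℚ a * t * (recip b * X) + ℕ→ℚ 2 * X * (t * t)    ≡⟨ cong (λ q → ℕ→ℚ a * t * q + ℕ→ℚ 2 * X * (t * t)) (recip-* m) ⟩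
    ℕ→ℚ a * t * 1ℚ + ℕ→ℚ 2 * X * (t * t)               ≡⟨ cong (_+ ℕ→ℚ 2 * X * (t * t)) (ℚ.*-identityʳ (ℕ→ℚ a * t)) ⟩
    ℕ→ℚ a * t + ℕ→ℚ 2 * X * (t * t)                    ∎
    where
    open ≡-Reasoning
    reassociate : ∀ X θ L s → X * (θ * L) * s ≡ X * θ * (L * s)
    reassociate = solve-∀ ℚ-ring
    expand : ∀ X a r ε → X * (a * r + ε) * (ε * recip 2)
                         ≡ a * (ε * recip 2) * (r * X) + ℕ→ℚ 2 * X * (ε * recip 2 * (ε * recip 2))
    expand = solve-∀ ℚ-ring

  mgf-factor : ∀ a f → a ℕ.+ f ≡ b → R * (ℕ→ℚ f + ℕ→ℚ a * w) ≤ X * u ^ℚ c a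
  mgf-factor a f a+f≡b = begin
    R * (ℕ→ℚ f + ℕ→ℚ a * w)
      ≤⟨ mgf-bound (ℕ→ℚ-nonNeg a) (ℕ→ℚ-nonNeg f) 0≤t t≤1 0≤y 6y≤t² w≤1+t+t² ⟩
    (ℕ→ℚ f + ℕ→ℚ a) + ℕ→ℚ a * t + ℕ→ℚ 2 * (ℕ→ℚ f + ℕ→ℚ a) * (t * t)
      ≡⟨ cong (λ x → x + ℕ→ℚ a * t + ℕ→ℚ 2 * x * (t * t)) f+a≡X ⟩
    X + ℕ→ℚ a * t + ℕ→ℚ 2 * X * (t * t)
      ≡⟨ ℚ.+-assoc X _ _ ⟩
    X + (ℕ→ℚ a * t + ℕ→ℚ 2 * X * (t * t))
      ≡⟨ cong (_+_ X) (sym (X*c*s≡at+2Xt² a)) ⟩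
    X + X * ℕ→ℚ (c a) * s
      ≡⟨ factor X (ℕ→ℚ (c a)) s ⟩
    X * (1ℚ + ℕ→ℚ (c a) * s)
      ≤⟨ *-monoˡ-≤ (ℕ→ℚ-nonNeg b) (1+ks≤[1+s]^k (c a) 0≤s) ⟩
    X * u ^ℚ c a ∎
    where
    open ℚ.≤-Reasoning
    f+a≡X : ℕ→ℚ f + ℕ→ℚ a ≡ X
    f+a≡X = trans (sym (ℕ→ℚ-homo-+ f a)) (cong ℕ→ℚ (trans (ℕ.+-comm f a) a+f≡b))
    factor : ∀ X C s → X + X * C * s ≡ X * (1ℚ + C * s)
    factor = solve-∀ ℚ-ring

  upper-exponent : ∀ j → (recip b + ε) * ℕ→ℚ n < ℕ→ℚ j → c 1 ℕ.* n ℕ.≤ L ℕ.* j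
  upper-exponent j above = scaled-threshold {θ 1} L (c 1) (θ*L≡c 1)
    (ℚ.≤-trans (ℚ.≤-reflexive (cong (λ q → (q + ε) * ℕ→ℚ n) (ℚ.*-identityˡ (recip b)))) (ℚ.<⇒≤ above))

  lower-exponent : ∀ j k → j ℕ.+ k ≡ n → ℕ→ℚ j < (recip b - ε) * ℕ→ℚ n → c m ℕ.* n ℕ.≤ L ℕ.* k
  lower-exponent j k j+k≡n below = scaled-threshold {θ m} L (c m) (θ*L≡c m) (begin
    (ℕ→ℚ m * r + ε) * N                       ≡⟨ split (ℕ→ℚ m) r ε N ⟩
    r * (1ℚ + ℕ→ℚ m) * N - (r - ε) * N        ≡⟨ cong (λ q → q * N - (r - ε) * N) r*[1+m]≡1 ⟩
    1ℚ * N - (r - ε) * N                      ≡⟨ cong (_- (r - ε) * N) (ℚ.*-identityˡ N) ⟩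
    N - (r - ε) * N                           ≤⟨ ℚ.+-monoʳ-≤ N (ℚ.neg-antimono-≤ (ℚ.<⇒≤ below)) ⟩
    N - ℕ→ℚ j                                 ≡⟨ cong (_- ℕ→ℚ j) (trans (cong ℕ→ℚ (sym j+k≡n)) (ℕ→ℚ-homo-+ j k)) ⟩
    ℕ→ℚ j + ℕ→ℚ k - ℕ→ℚ j                     ≡⟨ cancel (ℕ→ℚ j) (ℕ→ℚ k) ⟩
    ℕ→ℚ k                                     ∎)
    where
    open ℚ.≤-Reasoning
    r = recip b
    N = ℕ→ℚ n
    r*[1+m]≡1 : r * (1ℚ + ℕ→ℚ m) ≡ 1ℚ
    r*[1+m]≡1 = trans (cong (r *_) (sym (ℕ→ℚ-suc m))) (recip-* m)
    split : ∀ M r ε N → (M * r + ε) * N ≡ r * (1ℚ + M) * N - (r - ε) * N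
    split = solve-∀ ℚ-ring
    cancel : ∀ j k → j + k - j ≡ k
    cancel = solve-∀ ℚ-ring

  threshold-power : ∀ a j → c a ℕ.* n ℕ.≤ L ℕ.* j → (u ^ℚ c a) ^ℚ n ≤ w ^ℚ j
  threshold-power a j cn≤Lj = begin
    (u ^ℚ c a) ^ℚ n   ≡⟨ ^ℚ-assocʳ u (c a) n ⟩
    u ^ℚ (c a ℕ.* n)  ≤⟨ ^ℚ-monoʳ-≤ 1≤u cn≤Lj ⟩
    u ^ℚ (L ℕ.* j)    ≡⟨ sym (^ℚ-assocʳ u L j) ⟩
    w ^ℚ j            ∎
    where open ℚ.≤-Reasoning

  E : ℕ → ℚ
  E K = expPartial (ε * ε * ℕ→ℚ n * recip 80) K

  0≤E : ∀ K → 0ℚ ≤ E K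
  0≤E K = expPartial-nonNeg K (*-nonNeg (*-nonNeg (*-nonNeg 0≤ε 0≤ε) (ℕ→ℚ-nonNeg n)) (recip-nonNeg 80))

  E≤Rⁿ : ∀ K → E K ≤ R ^ℚ n
  E≤Rⁿ K = begin
    expPartial (ε * ε * ℕ→ℚ n * recip 80) K    ≡⟨ cong (λ x → expPartial x K) (reorder ε (ℕ→ℚ n)) ⟩
    expPartial (ℕ→ℚ n * y) K                   ≤⟨ expPartial-*ℕ n K 0≤y ⟩
    expPartial y K ^ℚ n                        ≤⟨ ^ℚ-monoˡ-≤ n (expPartial-nonNeg K 0≤y) (expPartial≤1+2y K 0≤y y≤1) ⟩
    R ^ℚ n                                     ∎
    where
    open ℚ.≤-Reasoning
    reorder : ∀ ε n → ε * ε * n * recip 80 ≡ n * (ε * ε * recip 80)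
    reorder = solve-∀ ℚ-ring

  P₊ P₋ Z : ℚ
  P₊ = u ^ℚ c 1
  P₋ = u ^ℚ c m
  Z  = P₊ ^ℚ n * P₋ ^ℚ n

  0≤P₊ⁿ : 0ℚ ≤ P₊ ^ℚ n
  0≤P₊ⁿ = ^ℚ-nonNeg n (^ℚ-nonNeg (c 1) 0≤u)

  0≤P₋ⁿ : 0ℚ ≤ P₋ ^ℚ n
  0≤P₋ⁿ = ^ℚ-nonNeg n (^ℚ-nonNeg (c m) 0≤u)

  0<Z : 0ℚ < Z
  0<Z = *-pos (P-pos (c 1)) (P-pos (c m))
    where
    P-pos : ∀ k → 0ℚ < (u ^ℚ k) ^ℚ n
    P-pos k = ^ℚ-pos n (^ℚ-pos k (ℚ.<-≤-trans (ℚ.positive⁻¹ 1ℚ) 1≤u))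

  mgf-sum : ∀ {A B P} → 0ℚ ≤ A → 0ℚ ≤ B → R * (A + ℕ→ℚ m * B) ≤ X * P →
            R ^ℚ n * sumℚ (blockWeight A B) (blocks b n) ≤ (X * P) ^ℚ n
  mgf-sum {A} {B} {P} 0≤A 0≤B R[A+mB]≤XP = begin
    R ^ℚ n * sumℚ (blockWeight A B) (blocks b n)   ≡⟨ cong (R ^ℚ n *_) (sumℚ-blockWeight m n A B) ⟩
    R ^ℚ n * (A + ℕ→ℚ m * B) ^ℚ n                  ≡⟨ sym (^ℚ-distrib-* R (A + ℕ→ℚ m * B) n) ⟩
    (R * (A + ℕ→ℚ m * B)) ^ℚ n                     ≤⟨ ^ℚ-monoˡ-≤ n 0≤R[A+mB] R[A+mB]≤XP ⟩
    (X * P) ^ℚ n                                   ∎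
    where
    open ℚ.≤-Reasoning
    0≤R[A+mB] = *-nonNeg 0≤R (+-nonNeg 0≤A (*-nonNeg (ℕ→ℚ-nonNeg m) 0≤B))

  -- Multiplying by Z = P₊ⁿ P₋ⁿ clears the denominators of both tail estimates.
  weight : Vec (Fin b) n → ℚ
  weight v = P₋ ^ℚ n * (R ^ℚ n * blockWeight w 1ℚ v) + P₊ ^ℚ n * (R ^ℚ n * blockWeight 1ℚ w v)

  weight-nonNeg : ∀ v → 0ℚ ≤ weight v
  weight-nonNeg v = +-nonNeg (*-nonNeg 0≤P₋ⁿ (*-nonNeg 0≤Rⁿ (blockWeight-nonNeg 0≤w 0≤1 v)))
                             (*-nonNeg 0≤P₊ⁿ (*-nonNeg 0≤Rⁿ (blockWeight-nonNeg 0≤1 0≤w v)))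
    where
    0≤Rⁿ = ^ℚ-nonNeg n 0≤R

  tail≤weight : ∀ K v → ((recip b + ε) * ℕ→ℚ n < ℕ→ℚ (zeros v)) ⊎ (ℕ→ℚ (zeros v) < (recip b - ε) * ℕ→ℚ n) →
                E K * Z ≤ weight v
  tail≤weight K v (inj₁ above) = begin
    E K * (P₊ ^ℚ n * P₋ ^ℚ n)                   ≤⟨ *-mono-≤ (0≤E K) (ℚ.<⇒≤ 0<Z) (E≤Rⁿ K)
                                                     (*-monoʳ-≤ 0≤P₋ⁿ (threshold-power 1 (zeros v) (upper-exponent (zeros v) above))) ⟩
    R ^ℚ n * (w ^ℚ zeros v * P₋ ^ℚ n)           ≡⟨ rearrange (R ^ℚ n) (w ^ℚ zeros v) (P₋ ^ℚ n) ⟩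
    P₋ ^ℚ n * (R ^ℚ n * (w ^ℚ zeros v * 1ℚ))    ≡⟨ cong (λ q → P₋ ^ℚ n * (R ^ℚ n * (w ^ℚ zeros v * q))) (sym (1^ℚ (nonzeros v))) ⟩
    P₋ ^ℚ n * (R ^ℚ n * blockWeight w 1ℚ v)     ≤⟨ p≤p+q (*-nonNeg 0≤P₊ⁿ (*-nonNeg (^ℚ-nonNeg n 0≤R) (blockWeight-nonNeg 0≤1 0≤w v))) ⟩
    weight v                                    ∎
    where
    open ℚ.≤-Reasoning
    rearrange : ∀ R W P → R * (W * P) ≡ P * (R * (W * 1ℚ))
    rearrange = solve-∀ ℚ-ring
  tail≤weight K v (inj₂ below) = begin
    E K * (P₊ ^ℚ n * P₋ ^ℚ n)                   ≤⟨ *-mono-≤ (0≤E K) (ℚ.<⇒≤ 0<Z) (E≤Rⁿ K)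
                                                     (*-monoˡ-≤ 0≤P₊ⁿ (threshold-power m (nonzeros v) (lower-exponent (zeros v) (nonzeros v) (zeros+nonzeros v) below))) ⟩
    R ^ℚ n * (P₊ ^ℚ n * w ^ℚ nonzeros v)        ≡⟨ rearrange (R ^ℚ n) (P₊ ^ℚ n) (w ^ℚ nonzeros v) ⟩
    P₊ ^ℚ n * (R ^ℚ n * (1ℚ * w ^ℚ nonzeros v)) ≡⟨ cong (λ q → P₊ ^ℚ n * (R ^ℚ n * (q * w ^ℚ nonzeros v))) (sym (1^ℚ (zeros v))) ⟩
    P₊ ^ℚ n * (R ^ℚ n * blockWeight 1ℚ w v)     ≤⟨ q≤p+q (*-nonNeg 0≤P₋ⁿ (*-nonNeg (^ℚ-nonNeg n 0≤R) (blockWeight-nonNeg 0≤w 0≤1 v))) ⟩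
    weight v                                    ∎
    where
    open ℚ.≤-Reasoning
    rearrange : ∀ R P W → R * (P * W) ≡ P * (R * (1ℚ * W))
    rearrange = solve-∀ ℚ-ring

  weight-sum : sumℚ weight (blocks b n) ≤ ℕ→ℚ 2 * X ^ℚ n * Z
  weight-sum = begin
    sumℚ weight Bs
      ≡⟨ sumℚ-+ (λ v → P₋ⁿ * (Rⁿ * blockWeight w 1ℚ v)) (λ v → P₊ⁿ * (Rⁿ * blockWeight 1ℚ w v)) Bs ⟩
    sumℚ (λ v → P₋ⁿ * (Rⁿ * blockWeight w 1ℚ v)) Bs + sumℚ (λ v → P₊ⁿ * (Rⁿ * blockWeight 1ℚ w v)) Bs
      ≡⟨ cong₂ _+_ (factor P₋ⁿ (blockWeight w 1ℚ)) (factor P₊ⁿ (blockWeight 1ℚ w)) ⟩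
    P₋ⁿ * (Rⁿ * sumℚ (blockWeight w 1ℚ) Bs) + P₊ⁿ * (Rⁿ * sumℚ (blockWeight 1ℚ w) Bs)
      ≤⟨ ℚ.+-mono-≤ (*-monoˡ-≤ 0≤P₋ⁿ (mgf-sum 0≤w 0≤1 mgf₊)) (*-monoˡ-≤ 0≤P₊ⁿ (mgf-sum 0≤1 0≤w (mgf-factor m 1 (ℕ.+-comm m 1)))) ⟩
    P₋ⁿ * (X * P₊) ^ℚ n + P₊ⁿ * (X * P₋) ^ℚ n
      ≡⟨ cong₂ (λ p q → P₋ⁿ * p + P₊ⁿ * q) (^ℚ-distrib-* X P₊ n) (^ℚ-distrib-* X P₋ n) ⟩
    P₋ⁿ * (X ^ℚ n * P₊ⁿ) + P₊ⁿ * (X ^ℚ n * P₋ⁿ)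
      ≡⟨ symmetrise P₊ⁿ P₋ⁿ (X ^ℚ n) ⟩
    ℕ→ℚ 2 * X ^ℚ n * Z ∎
    where
    open ℚ.≤-Reasoning
    Bs = blocks b n
    Rⁿ = R ^ℚ n
    P₊ⁿ = P₊ ^ℚ n
    P₋ⁿ = P₋ ^ℚ n
    factor : ∀ P h → sumℚ (λ v → P * (Rⁿ * h v)) Bs ≡ P * (Rⁿ * sumℚ h Bs)
    factor P h = trans (sumℚ-*ˡ P (λ v → Rⁿ * h v) Bs) (cong (P *_) (sumℚ-*ˡ Rⁿ h Bs))
    mgf₊ : R * (w + ℕ→ℚ m * 1ℚ) ≤ X * P₊
    mgf₊ = ℚ.≤-trans (ℚ.≤-reflexive (cong (R *_) (reorder (ℕ→ℚ m) w))) (mgf-factor 1 m refl)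
      where
      reorder : ∀ M w → w + M * 1ℚ ≡ M + ℕ→ℚ 1 * w
      reorder = solve-∀ ℚ-ring
    symmetrise : ∀ p q x → q * (x * p) + p * (x * q) ≡ ℕ→ℚ 2 * x * (p * q)
    symmetrise = solve-∀ ℚ-ring

  tail? : ∀ j → Dec (((recip b + ε) * ℕ→ℚ n < ℕ→ℚ j) ⊎ (ℕ→ℚ j < (recip b - ε) * ℕ→ℚ n))
  tail? j = ((recip b + ε) * ℕ→ℚ n ℚ.<? ℕ→ℚ j) ⊎-dec (ℕ→ℚ j ℚ.<? (recip b - ε) * ℕ→ℚ n)

  tail-bound : ∀ K → E K * ℕ→ℚ (tailSum b n ε) ≤ ℕ→ℚ (2 ℕ.* b ℕ.^ n)
  tail-bound K = *-cancelʳ-≤ 0<Z (begin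
    E K * T * Z                  ≡⟨ *-Properties.xy∙z≈y∙xz (E K) T Z ⟩
    T * (E K * Z)                ≤⟨ markov zeros weight (Unique.filter⁺ tail? (Unique.upTo⁺ (suc n))) weight-nonNeg
                                      (λ v zv∈J → tail≤weight K v (proj₂ (∈-filter⁻ tail? zv∈J))) (blocks b n) ⟩
    sumℚ weight (blocks b n)     ≤⟨ weight-sum ⟩
    ℕ→ℚ 2 * X ^ℚ n * Z           ≡⟨ cong (_* Z) (sym (trans (ℕ→ℚ-homo-* 2 (b ℕ.^ n)) (cong (ℕ→ℚ 2 *_) (ℕ→ℚ-homo-^ b n)))) ⟩
    ℕ→ℚ (2 ℕ.* b ℕ.^ n) * Z      ∎)
    where
    open ℚ.≤-Reasoning
    T = ℕ→ℚ (tailSum b n ε)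

mainTheorem4 : (b n : ℕ) → 2 ℕ.≤ b → b ℕ.^ 16 ℕ.≤ n → (ε : ℚ)
    → 0ℚ < ε → 1ℚ ≤ (ε ^ℚ 3) * ℕ→ℚ n → ε ≤ ℕ→ℚ 2 * recip b
    → (K : ℕ) → expPartial ((ε * ε) * ℕ→ℚ n * recip 80) K * ℕ→ℚ (tailSum b n ε) ≤ ℕ→ℚ (2 ℕ.^ 14 ℕ.* b ℕ.^ n)
mainTheorem4 (suc m) n 2≤b _ ε 0<ε _ ε≤2/b K = ℚ.≤-trans (Chernoff.tail-bound m n (ℚ.<⇒≤ 0<ε) ε≤1 K) 2bⁿ≤2¹⁴bⁿ
  where
  ε≤1 : ε ≤ 1ℚ
  ε≤1 = ℚ.≤-trans ε≤2/b (ℕ→ℚ-*-recip≤1 2≤b)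
  2bⁿ≤2¹⁴bⁿ : ℕ→ℚ (2 ℕ.* suc m ℕ.^ n) ≤ ℕ→ℚ (2 ℕ.^ 14 ℕ.* suc m ℕ.^ n)
  2bⁿ≤2¹⁴bⁿ = ℕ→ℚ-mono-≤ (ℕ.*-monoˡ-≤ (suc m ℕ.^ n) (ℕ.m≤m+n 2 16382))
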